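{- Let $\alpha$ be a positive rational number and let $\mathcal T_1=(T_1,\nu_1)$, $\mathcal T_2=(T_2,\nu_2)$ be factorization trees for $\alpha$. Then: (i) a map $\sigma:V(T_1)\to V(T_2)$ is an isomorphism if and only if it is a surjective homomorphism; (ii) if $\mathcal T_1\cong\mathcal T_2$ then there exists a unique isomorphism from $\mathcal T_1$ to $\mathcal T_2$; (iii) for any factorization tree $\mathcal T$ for $\alpha$, the identity map is the only isomorphism from $\mathcal T$ to itself.
   Context: Write $\alpha=a/b$ with $a,b$ coprime positive integers. Let $p_1\ge\cdots\ge p_N$ be the primes dividing $ab$, listed with multiplicity. Put $\gamma(i)=1$ if $p_i\mid a$, $\gamma(i)=-1$ if $p_i\mid b$, and $\alpha_n=\prod_{i=1}^n p_i^{\gamma(i)}$ for $0\le n\le N$. A factorization of a positive rational $\beta$ is a sequence $(a_1/b_1,a_2/b_2,\dots)$ with $a_i,b_i$ positive integers, $a_i=b_i=1$ for all but finitely many $i$, $\prod_i a_i/b_i=\beta$, $\max\{a_i,b_i\}\ge\max\{a_{i+1},b_{i+1}\}$ for all $i$, and $\gcd(a_i,b_j)=1$ for all $i,j$. Let $\mathfrak F_\alpha$ be the set of all factorizations of $\alpha_n$, $0\le n\le N$. For $0\le n<N$, a factorization $(a_i/b_i)$ of $\alpha_n$ is a direct subfactorization of a factorization $(c_i/d_i)$ of $\alpha_{n+1}$ if either $p_{n+1}\mid a$ and for some $k$: $d_i=b_i$ for all $i$, $c_i=a_i$ for $i\ne k$, $c_k=a_kp_{n+1}$; or $p_{n+1}\mid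 b$ and for some $k$: $c_i=a_i$ for all $i$, $d_i=b_i$ for $i\ne k$, $d_k=b_kp_{n+1}$. A tree data structure for a set $X$ is a pair $(T,\nu)$ with $T$ a rooted tree (digraph with edges from each vertex to its children) and $\nu:V(T)\to X$ a map; $\phi$ denotes the parenting map. A factorization tree for $\alpha$ is a tree data structure $(T,\nu)$ for $\mathfrak F_\alpha$ such that: (1) the root $r_0$ has $\nu(r_0)=(1,1,\dots)$; (2) if $n<N$ and $\nu(r)$ is a factorization of $\alpha_n$ then $r$ has a child; (3) $\nu(r)=\nu(s)$ and $\phi(r)=\phi(s)$ imply $r=s$; (4) for non-root $r$, $\nu(\phi(r))$ is a direct subfactorization of $\nu(r)$. A homomorphism from $(T_1,\nu_1)$ to $(T_2,\nu_2)$ is a map $\sigma:V(T_1)\to V(T_2)$ with $(\sigma(g),\sigma(h))\in E(T_2)$ whenever $(g,h)\in E(T_1)$ and $\nu_2\circ\sigma=\nu_1$. An isomorphism is a bijective homomorphism $\sigma$ with $(g,h)\in E(T_1)\iff(\sigma(g),\sigma(h))\in E(T_2)$; $\mathcal T_1\cong\mathcal T_2$ means an isomorphism exists. -}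

module Defs where

open import Data.Nat using (ℕ; zero; suc; _+_; _*_; _≤_; _<_; _⊔_)
open import Data.Nat.Divisibility using (_∣_; _∣?_)
open import Data.Nat.Coprimality using (Coprime)
open import Data.Nat.Primality using (Prime)
open import Data.Integer using (∣_∣)
open import Data.Rational using (ℚ; ↥_; ↧ₙ_)
open import Data.List using (List; []; _∷_; length; lookup; take)
open import Data.Nat.ListAction using (product)
open import Data.List.Relation.Unary.All using (All)
open import Data.List.Relation.Unary.Linked using (Linked)
open import Data.Fin using (Fin; toℕ)
open import Data.Product using (Σ; ∃; _×_; _,_; proj₁; proj₂)
open import Data.Sum using (_⊎_)
open import Data.Maybe using (Maybe; just; nothing)
open import Data.Bool using (if_then_else_)
open import Relation.Nullary using (¬_; does)
open import Relation.Binary.PropositionalEquality using (_≡_; _≢_)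

numᵅ : ℚ → ℕ
numᵅ α = ∣ ↥ α ∣

denᵅ : ℚ → ℕ
denᵅ α = ↧ₙ α

-- The primes p₁ ≥ ⋯ ≥ p_N dividing a·b, listed with multiplicity:
-- a list of primes, non-increasing, whose product is a·b
-- (such a list exists and is unique by the fundamental theorem of arithmetic).
record PrimeList (α : ℚ) : Set where
  field
    ps       : List ℕ
    allPrime : All Prime ps
    nonincr  : Linked (λ p q → q ≤ p) ps
    prod     : product ps ≡ numᵅ α * denᵅ α
open PrimeList public

-- α_n as a pair (numerator , denominator):
-- a prime p_i dividing a multiplies the numerator (γ(i) = 1),
-- otherwise (then p_i ∣ b) it multiplies the denominator (γ(i) = -1).
alphaL : ℕ → List ℕ → ℕ × ℕ
alphaL a [] = 1 , 1
alphaL a (p ∷ qs) with alphaL a qs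
... | x , y = if does (p ∣? a) then (p * x , y) else (x , p * y)

alpha : (α : ℚ) → PrimeList α → ℕ → ℕ × ℕ
alpha α P n = alphaL (numᵅ α) (take n (ps P))

N : {α : ℚ} → PrimeList α → ℕ
N P = length (ps P)

-- Sequences (a₁/b₁, a₂/b₂, …), indexed from 0.

Seq : Set
Seq = ℕ → ℕ × ℕ

num : Seq → ℕ → ℕ
num f i = proj₁ (f i)

den : Seq → ℕ → ℕ
den f i = proj₂ (f i)

_≈ₛ_ : Seq → Seq → Set
f ≈ₛ g = ∀ i → f i ≡ g i

trivialSeq : Seq
trivialSeq i = 1 , 1

prodUpTo : (ℕ → ℕ) → ℕ → ℕ
prodUpTo h zero = 1
prodUpTo h (suc K) = prodUpTo h K * h K

record IsFactorization (f : Seq) (β : ℕ × ℕ) : Set where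
  field
    positive : ∀ i → 1 ≤ num f i × 1 ≤ den f i
    support  : Σ ℕ λ K → (∀ i → K ≤ i → num f i ≡ 1 × den f i ≡ 1)
                        × (prodUpTo (num f) K * proj₂ β ≡ proj₁ β * prodUpTo (den f) K)
    nonincr  : ∀ i → num f (suc i) ⊔ den f (suc i) ≤ num f i ⊔ den f i
    coprime  : ∀ i j → Coprime (num f i) (den f j)

In𝔉 : (α : ℚ) → PrimeList α → Seq → Set
In𝔉 α P f = Σ ℕ λ n → n ≤ N P × IsFactorization f (alpha α P n)

-- f (a factorization of α_n) is a direct subfactorization of g
-- (a factorization of α_{n+1}), with p = p_{n+1} = lookup ps i, n = toℕ i
DirectSub : (α : ℚ) → PrimeList α → Seq → Seq → Set
DirectSub α P f g =
  Σ (Fin (N P)) λ i →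
    IsFactorization f (alpha α P (toℕ i))
    × IsFactorization g (alpha α P (suc (toℕ i)))
    × (  (lookup (ps P) i ∣ numᵅ α
           × Σ ℕ λ k → (∀ j → den g j ≡ den f j)
                     × (∀ j → j ≢ k → num g j ≡ num f j)
                     × num g k ≡ num f k * lookup (ps P) i)
       ⊎ (lookup (ps P) i ∣ denᵅ α
           × Σ ℕ λ k → (∀ j → num g j ≡ num f j)
                     × (∀ j → j ≢ k → den g j ≡ den f j)
                     × den g k ≡ den f k * lookup (ps P) i))

-- Rooted trees, given by a parenting map; edges go from a vertex to its
-- children: (g , h) ∈ E  iff  parent h ≡ just g.

data ReachesRoot {V : Set} (parent : V → Maybe V) (root : V) : V → Set where
  here : ReachesRoot parent root root
  step : ∀ {v u} → parent v ≡ just u → ReachesRoot parent root u → ReachesRoot parent root v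

record FactTree (α : ℚ) (P : PrimeList α) : Set₁ where
  field
    V       : Set
    root    : V
    parent  : V → Maybe V
    parent-root    : parent root ≡ nothing
    parent-nothing : ∀ v → parent v ≡ nothing → v ≡ root
    rooted         : ∀ v → ReachesRoot parent root v
    ν       : V → Seq
    ν∈𝔉     : ∀ v → In𝔉 α P (ν v)
    cond1   : ν root ≈ₛ trivialSeq
    cond2   : ∀ r n → n < N P → IsFactorization (ν r) (alpha α P n)
              → Σ V λ c → parent c ≡ just r
    cond3   : ∀ r s → ν r ≈ₛ ν s → parent r ≡ parent s → r ≡ s
    cond4   : ∀ r u → parent r ≡ just u → DirectSub α P (ν u) (ν r)
open FactTree public

Edge : {α : ℚ} {P : PrimeList α} (T : FactTree α P) → V T → V T → Set
Edge T g h = parent T h ≡ just g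

IsHom : {α : ℚ} {P : PrimeList α} (T₁ T₂ : FactTree α P) → (V T₁ → V T₂) → Set
IsHom T₁ T₂ σ = (∀ g h → Edge T₁ g h → Edge T₂ (σ g) (σ h))
              × (∀ v → ν T₂ (σ v) ≈ₛ ν T₁ v)

Injective : {A B : Set} → (A → B) → Set
Injective σ = ∀ x y → σ x ≡ σ y → x ≡ y

Surjective : {A B : Set} → (A → B) → Set
Surjective {A} σ = ∀ y → Σ A λ x → σ x ≡ y

IsIso : {α : ℚ} {P : PrimeList α} (T₁ T₂ : FactTree α P) → (V T₁ → V T₂) → Set
IsIso T₁ T₂ σ = IsHom T₁ T₂ σ × (Injective σ × Surjective σ)
              × (∀ g h → Edge T₁ g h ⇔ Edge T₂ (σ g) (σ h))
  where
  _⇔_ : Set → Set → Set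
  A ⇔ B = (A → B) × (B → A)

_≅_ : {α : ℚ} {P : PrimeList α} (T₁ T₂ : FactTree α P) → Set
T₁ ≅ T₂ = Σ (V T₁ → V T₂) λ σ → IsIso T₁ T₂ σ

module Submission where

-- The whole corollary rests on one observation: in a factorization tree
-- only the root is labelled by the trivial factorization (1,1,…), because
-- every other vertex is labelled by a factorization obtained from its
-- parent's label by multiplying one entry by a prime, and a prime multiple
-- is never 1.  Consequently a homomorphism σ : T₁ → T₂, which preserves
-- labels, sends the root to the root.  Condition (3) (siblings carry
-- distinct labels) then pins σ down vertex by vertex along the path to the
-- root, which gives
--   * uniqueness: any two homomorphisms T₁ → T₂ coincide;
--   * injectivity: σ x ≡ σ y forces x ≡ y;
--   * edge reflection: an edge σ g → σ h of T₂ comes from an edge g → h.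

open import Defs
open import Data.Rational using (ℚ; Positive)
open import Data.Product using (Σ; _×_; _,_; proj₁; proj₂)
open import Data.Nat using (_*_)
open import Data.Nat.Base using (nonTrivial⇒≢1)
open import Data.Nat.Properties using (m*n≡1⇒n≡1)
open import Data.Nat.Primality using (Prime; prime⇒nonTrivial)
open import Data.Fin using (Fin)
open import Data.List using (lookup)
open import Data.List.Relation.Unary.All as All using ()
open import Data.List.Membership.Propositional.Properties using (∈-lookup)
open import Data.Sum using (inj₁; inj₂)
open import Data.Maybe using (just)
open import Data.Maybe.Properties using (just-injective)
open import Data.Empty using (⊥-elim)
open import Function using (id)
open import Relation.Nullary using (¬_)
open import Relation.Binary.PropositionalEquality
  using (_≡_; _≢_; refl; sym; trans; cong; subst)

prime-multiple≢1 : ∀ {p} → Prime p → ∀ m → m * p ≢ 1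
prime-multiple≢1 pp m eq = nonTrivial⇒≢1 {{prime⇒nonTrivial pp}} (m*n≡1⇒n≡1 m _ eq)

listed-prime : ∀ {α : ℚ} (P : PrimeList α) (i : Fin (N P)) → Prime (lookup (ps P) i)
listed-prime P i = All.lookup (allPrime P) (∈-lookup i)

-- The larger factorization in a direct subfactorization step is never
-- trivial: one of its entries is a prime multiple of an entry of the smaller.
directSub-nontrivial : ∀ {α : ℚ} {P : PrimeList α} {f g : Seq}
                     → DirectSub α P f g → ¬ (g ≈ₛ trivialSeq)
directSub-nontrivial {P = P} {f} (i , _ , _ , inj₁ (_ , k , _ , _ , num-k)) g-trivial =
  prime-multiple≢1 (listed-prime P i) (num f k) (trans (sym num-k) (cong proj₁ (g-trivial k)))
directSub-nontrivial {P = P} {f} (i , _ , _ , inj₂ (_ , k , _ , _ , den-k)) g-trivial =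
  prime-multiple≢1 (listed-prime P i) (den f k) (trans (sym den-k) (cong proj₂ (g-trivial k)))

module _ {α : ℚ} {P : PrimeList α} where

  trivial⇒root : (T : FactTree α P) → ∀ v → ν T v ≈ₛ trivialSeq → v ≡ root T
  trivial⇒root T v v-trivial with rooted T v
  ... | here = refl
  ... | step {u = u} pv _ = ⊥-elim (directSub-nontrivial {α} {P} (cond4 T v u pv) v-trivial)

  no-edge-into-root : (T : FactTree α P) → ∀ x → ¬ Edge T x (root T)
  no-edge-into-root T x e with trans (sym e) (parent-root T)
  ... | ()

  module Homomorphism (T₁ T₂ : FactTree α P) (σ : V T₁ → V T₂) (hσ : IsHom T₁ T₂ σ) where

    preserves-edges : ∀ g h → Edge T₁ g h → Edge T₂ (σ g) (σ h)
    preserves-edges = proj₁ hσ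

    preserves-labels : ∀ v → ν T₂ (σ v) ≈ₛ ν T₁ v
    preserves-labels = proj₂ hσ

    -- σ maps root to root, since σ (root T₁) has the trivial label.
    preserves-root : σ (root T₁) ≡ root T₂
    preserves-root = trivial⇒root T₂ (σ (root T₁))
      (λ i → trans (preserves-labels (root T₁) i) (cond1 T₁ i))

    nonroot↦nonroot : ∀ {u v} → Edge T₁ u v → σ v ≢ root T₂
    nonroot↦nonroot {u} {v} uv σv≡root =
      no-edge-into-root T₂ (σ u) (subst (Edge T₂ (σ u)) σv≡root (preserves-edges u v uv))

    -- Injectivity, by induction on the paths from x and y to the root:
    -- equal images force equal parents (induction hypothesis), and then
    -- equal labels of siblings force equality by condition (3).
    injective-along : ∀ x y → ReachesRoot (parent T₁) (root T₁) x
                    → ReachesRoot (parent T₁) (root T₁) y → σ x ≡ σ y → x ≡ y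
    injective-along x y here here _ = refl
    injective-along x y here (step yw _) e =
      ⊥-elim (nonroot↦nonroot yw (trans (sym e) preserves-root))
    injective-along x y (step xu _) here e =
      ⊥-elim (nonroot↦nonroot xu (trans e preserves-root))
    injective-along x y (step {u = u} xu ru) (step {u = w} yw rw) e =
      cond3 T₁ x y same-label (trans xu (trans (cong just u≡w) (sym yw)))
      where
      same-label : ν T₁ x ≈ₛ ν T₁ y
      same-label i = trans (sym (preserves-labels x i))
                       (trans (cong (λ z → ν T₂ z i) e) (preserves-labels y i))
      σu≡σw : σ u ≡ σ w
      σu≡σw = just-injective (trans (sym (preserves-edges u x xu))
                (trans (cong (parent T₂) e) (preserves-edges w y yw)))
      u≡w : u ≡ w
      u≡w = injective-along u w ru rw σu≡σw

    injective : Injective σ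
    injective x y = injective-along x y (rooted T₁ x) (rooted T₁ y)

    -- An edge σ g → σ h of T₂ comes from the edge g → h of T₁: h is not the
    -- root, and its parent w satisfies σ w ≡ σ g, hence w ≡ g.
    reflects-edges : ∀ g h → Edge T₂ (σ g) (σ h) → Edge T₁ g h
    reflects-edges g h e with rooted T₁ h
    ... | here = ⊥-elim (no-edge-into-root T₂ (σ g) (subst (Edge T₂ (σ g)) preserves-root e))
    reflects-edges g h e | step {u = w} hw _ =
      subst (λ z → Edge T₁ z h) w≡g hw
      where
      w≡g : w ≡ g
      w≡g = injective w g (just-injective (trans (sym (preserves-edges w h hw)) e))

    surjective⇒iso : Surjective σ → IsIso T₁ T₂ σ
    surjective⇒iso onto =
      hσ , (injective , onto) , λ g h → preserves-edges g h , reflects-edges g h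

  -- Any two homomorphisms T₁ → T₂ agree: both send the root to the root,
  -- and by condition (3) agreement on a parent propagates to its children.
  homs-agree : (T₁ T₂ : FactTree α P) (σ τ : V T₁ → V T₂)
             → IsHom T₁ T₂ σ → IsHom T₁ T₂ τ → ∀ v → σ v ≡ τ v
  homs-agree T₁ T₂ σ τ hσ hτ v = along v (rooted T₁ v)
    where
    module Hσ = Homomorphism T₁ T₂ σ hσ
    module Hτ = Homomorphism T₁ T₂ τ hτ
    along : ∀ v → ReachesRoot (parent T₁) (root T₁) v → σ v ≡ τ v
    along _ here = trans Hσ.preserves-root (sym Hτ.preserves-root)
    along v (step {u = u} vu ru) =
      cond3 T₂ (σ v) (τ v) (λ i → trans (Hσ.preserves-labels v i) (sym (Hτ.preserves-labels v i)))
        (trans (Hσ.preserves-edges u v vu)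
          (trans (cong just (along u ru)) (sym (Hτ.preserves-edges u v vu))))

  identity-hom : (T : FactTree α P) → IsHom T T id
  identity-hom T = (λ _ _ e → e) , (λ _ _ → refl)

corollary2p4 : (α : ℚ) → Positive α → (P : PrimeList α) → (T₁ T₂ : FactTree α P)
    → ((σ : V T₁ → V T₂)
         → (IsIso T₁ T₂ σ → IsHom T₁ T₂ σ × Surjective σ)
         × (IsHom T₁ T₂ σ × Surjective σ → IsIso T₁ T₂ σ))
    × (T₁ ≅ T₂ → Σ (V T₁ → V T₂) λ σ → IsIso T₁ T₂ σ
                   × ((τ : V T₁ → V T₂) → IsIso T₁ T₂ τ → ∀ v → τ v ≡ σ v))
    × ((T : FactTree α P) → IsIso T T (λ v → v)
         × ((σ : V T → V T) → IsIso T T σ → ∀ v → σ v ≡ v))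
corollary2p4 α _ P T₁ T₂ =
    (λ σ → (λ { (hσ , (_ , onto) , _) → hσ , onto })
         , (λ { (hσ , onto) → surjective⇒iso T₁ T₂ σ hσ onto }))
  -- (ii) every isomorphism agrees with the given one, being a homomorphism
  , (λ { (σ , iso) → σ , iso , λ τ isoτ → homs-agree T₁ T₂ τ σ (proj₁ isoτ) (proj₁ iso) })
  , (λ T → surjective⇒iso T T id (identity-hom T) (λ v → v , refl)
         , λ σ iso → homs-agree T T σ id (proj₁ iso) (identity-hom T))
  where open Homomorphism using (surjective⇒iso)
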